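{- If $n\ge 5$, then $\iota(K_n\,\Box\, C_n)=n$.
   Context: $K_n$ is the complete graph and $C_n$ the cycle on $n$ vertices; $\Box$ is the Cartesian product. A set $A$ of vertices is isolating if no two vertices outside the closed neighborhood $N[A]$ are adjacent; $\iota$ is the minimum size of an isolating set. -}

module Defs where

open import Data.Nat using (ℕ; suc; _%_; _+_; NonZero)
open import Data.Fin using (Fin; toℕ)
open import Data.Product using (_×_; _,_; ∃)
open import Data.Sum using (_⊎_)
open import Data.List using (List; length)
open import Data.List.Membership.Propositional using (_∈_)
open import Data.List.Relation.Unary.Unique.Propositional using (Unique)
open import Relation.Binary.PropositionalEquality using (_≡_)
open import Relation.Nullary using (¬_)

record Graph : Set₁ where
  field
    V   : Set
    Adj : V → V → Set
open Graph public

K : ℕ → Graph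
K n = record { V = Fin n ; Adj = λ i j → ¬ (i ≡ j) }

-- Cycle C_n on vertex set Fin n (meaningful for n ≥ 3):
-- i ~ j iff j ≡ i+1 (mod n) or i ≡ j+1 (mod n).
CycAdj : (n : ℕ) → Fin n → Fin n → Set
CycAdj (suc m) i j = (toℕ j ≡ (toℕ i + 1) % suc m) ⊎ (toℕ i ≡ (toℕ j + 1) % suc m)

C : ℕ → Graph
C n = record { V = Fin n ; Adj = CycAdj n }

_□_ : Graph → Graph → Graph
G □ H = record
  { V = V G × V H
  ; Adj = λ { (g , h) (g' , h') →
        (Adj G g g' × h ≡ h') ⊎ (g ≡ g' × Adj H h h') } }

InClosedNbhd : (G : Graph) → List (V G) → V G → Set
InClosedNbhd G A v = ∃ λ a → a ∈ A × (a ≡ v ⊎ Adj G a v)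

Isolating : (G : Graph) → List (V G) → Set
Isolating G A = ∀ u v → ¬ InClosedNbhd G A u → ¬ InClosedNbhd G A v → ¬ Adj G u v

IsolationNumber : (G : Graph) → ℕ → Set
IsolationNumber G k =
  (∃ λ A → Unique A × Isolating G A × length A ≡ k) ×
  (∀ A → Isolating G A → k Data.Nat.≤ length A)

module Submission where

-- The column {0} × Cₙ dominates Kₙ □ Cₙ, so ι ≤ n.  Conversely, let A be isolating.  Every layer
-- Kₙ × {c} is a clique, so at most one of its vertices lies outside N[A].  If every layer meets A,
-- then |A| ≥ n.  Otherwise take a layer c missed by A: all but one of its vertices (i , c) are
-- dominated from (i , c ± 1), which gives n − 1 vertices of A with distinct first coordinates in
-- the flanking layers c ± 1.  Either A has a further vertex off these two layers, or A lies inside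
-- them; then, as n ≥ 5, the layers c ± 2 and c ± 3 are missed as well, and the same argument at
-- c ± 2 puts n − 1 vertices of A into each of the layers c ± 1.

open import Defs
open import Data.Nat using (ℕ; suc; _+_; _*_; _%_; _≤_; _<_; s≤s; NonZero)
open import Data.Nat.Properties
  using (+-comm; +-assoc; +-identityʳ; ≤-trans; <⇒≱; m≤m+n; m≤n⇒∃[o]m+o≡n)
open import Data.Nat.DivMod
  using (_mod_; %-distribˡ-+; m%n%n≡m%n; [m+kn]%n≡m%n; %-remove-+ˡ; m<n⇒m%n≡m)
open import Data.Nat.Divisibility using (∣-refl; ∣⇒≤; m%n≡0⇒n∣m)
open import Data.Nat.Tactic.RingSolver using (solve-∀)
open import Data.Fin as Fin using (Fin; toℕ; #_; punchIn; _≟_)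
open import Data.Fin.Properties
  using (toℕ-fromℕ<; toℕ-injective; toℕ<n; injective⇒≤; all?; ¬∀⟶∃¬; punchInᵢ≢i)
open import Data.Product using (_×_; _,_; ∃; proj₁; proj₂)
open import Data.Product.Properties using (≡-dec)
open import Data.Sum using (_⊎_; inj₁; inj₂; [_,_]′)
open import Data.Empty using (⊥; ⊥-elim)
open import Data.List using (List; length; map; allFin; lookup)
open import Data.List.Properties using (length-map; length-tabulate)
open import Data.List.Membership.Propositional using (_∈_; _∉_; find; lose)
open import Data.List.Membership.Propositional.Properties using (∈-map⁺; ∈-allFin)
import Data.List.Membership.DecPropositional as DecMembership
open import Data.List.Relation.Unary.Any as Any using (any?)
open import Data.List.Relation.Unary.Any.Properties using (lookup-index)
open import Data.List.Relation.Unary.Unique.Propositional using (Unique)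
open import Data.List.Relation.Unary.Unique.Propositional.Properties using (map⁺; allFin⁺)
open import Function using (_∘_; id)
open import Function.Definitions using (Injective)
open import Relation.Binary.PropositionalEquality
  using (_≡_; _≢_; refl; sym; trans; cong; subst; ≢-sym; module ≡-Reasoning)
open import Relation.Nullary using (¬_; yes; no; contradiction)
open import Relation.Nullary.Decidable using (¬?; _⊎-dec_; decidable-stable)
open import Relation.Unary using (Pred; Decidable)

onto⇒≤length : ∀ {a} {X : Set a} {n} (xs : List X) (f : X → Fin n) →
               (∀ i → ∃ λ x → x ∈ xs × f x ≡ i) → n ≤ length xs
onto⇒≤length {n = n} xs f onto = injective⇒≤ position-injective
  where
  position : Fin n → Fin (length xs)
  position i = Any.index (proj₁ (proj₂ (onto i)))

  decodes : ∀ i → f (lookup xs (position i)) ≡ i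
  decodes i = trans (cong f (sym (lookup-index (proj₁ (proj₂ (onto i)))))) (proj₂ (proj₂ (onto i)))

  position-injective : Injective _≡_ _≡_ position
  position-injective {i} {j} eq = trans (sym (decodes i)) (trans (cong (f ∘ lookup xs) eq) (decodes j))

module _ {a p} {X : Set a} {P : Pred X p} (P? : Decidable P) where

  almost-onto⇒≤length : ∀ {n} (xs : List X) (g : X → Fin n) (e : Fin n) →
                        (∃ λ x → x ∈ xs × ¬ P x) →
                        (∀ i → i ≢ e → ∃ λ x → x ∈ xs × P x × g x ≡ i) → n ≤ length xs
  almost-onto⇒≤length {n} xs g e (w , w∈ , ¬Pw) hit = onto⇒≤length xs f onto
    where
    f : X → Fin n
    f x with P? x
    ... | yes _ = g x
    ... | no _  = e

    f-P : ∀ {x} → P x → f x ≡ g x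
    f-P {x} Px with P? x
    ... | yes _  = refl
    ... | no ¬Px = contradiction Px ¬Px

    f-¬P : ∀ {x} → ¬ P x → f x ≡ e
    f-¬P {x} ¬Px with P? x
    ... | yes Px = contradiction Px ¬Px
    ... | no _   = refl

    onto : ∀ i → ∃ λ x → x ∈ xs × f x ≡ i
    onto i with i ≟ e
    ... | yes refl = w , w∈ , f-¬P ¬Pw
    ... | no i≢e   with hit i i≢e
    ...   | x , x∈ , Px , gx≡i = x , x∈ , trans (f-P Px) gx≡i

all-but-one : ∀ {n p} {P : Pred (Fin (suc n)) p} → Decidable P →
              (∀ {i j} → i ≢ j → ¬ P i → ¬ P j → ⊥) → ∃ λ e → ∀ i → i ≢ e → P i
all-but-one {n} {P = P} P? clash with all? P?
... | yes all = Fin.zero , λ i _ → all i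
... | no ¬all with ¬∀⟶∃¬ (suc n) P P? ¬all
...   | e , ¬Pe = e , λ i i≢e → decidable-stable (P? i) (λ ¬Pi → clash i≢e ¬Pi ¬Pe)

MissesLayer : {X Y : Set} → List (X × Y) → Y → Set
MissesLayer A h = ∀ {v} → v ∈ A → proj₂ v ≢ h

dominating⇒isolating : ∀ G A → (∀ v → InClosedNbhd G A v) → Isolating G A
dominating⇒isolating G A dominated u _ u∉ _ _ = u∉ (dominated u)

column-dominates : ∀ {n} H (g : Fin n) {hs : List (V H)} → (∀ h → h ∈ hs) →
                   ∀ v → InClosedNbhd (K n □ H) (map (g ,_) hs) v
column-dominates H g every (i , h) with g ≟ i
... | yes g≡i = (g , h) , ∈-map⁺ (g ,_) (every h) , inj₁ (cong (_, h) g≡i)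
... | no g≢i  = (g , h) , ∈-map⁺ (g ,_) (every h) , inj₂ (inj₁ (g≢i , refl))

¬InClosedNbhd-□ : ∀ G H {A g h} → MissesLayer A h → (∀ {h′} → Adj H h′ h → (g , h′) ∉ A) →
                  ¬ InClosedNbhd (G □ H) A (g , h)
¬InClosedNbhd-□ G H misses ¬beside ((_ , _) , v∈ , inj₁ refl)                = misses v∈ refl
¬InClosedNbhd-□ G H misses ¬beside ((_ , _) , v∈ , inj₂ (inj₁ (_ , same)))   = misses v∈ same
¬InClosedNbhd-□ G H misses ¬beside ((_ , _) , v∈ , inj₂ (inj₂ (refl , adj))) = ¬beside adj v∈

toℕ-mod : ∀ x n .{{_ : NonZero n}} → toℕ (x mod n) ≡ x % n
toℕ-mod x n = toℕ-fromℕ< _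

[t+a]%n≡[t+b]%n : ∀ t {a b n} .{{_ : NonZero n}} → a % n ≡ b % n → (t + a) % n ≡ (t + b) % n
[t+a]%n≡[t+b]%n t {a} {b} {n} eq = begin
  (t + a) % n          ≡⟨ %-distribˡ-+ t a n ⟩
  (t % n + a % n) % n  ≡⟨ cong (λ r → (t % n + r) % n) eq ⟩
  (t % n + b % n) % n  ≡⟨ %-distribˡ-+ t b n ⟨
  (t + b) % n          ∎
  where open ≡-Reasoning

[c+a]%n≡[c+b]%n⇒a%n≡b%n : ∀ c {a b m} → (c + a) % suc m ≡ (c + b) % suc m → a % suc m ≡ b % suc m
[c+a]%n≡[c+b]%n⇒a%n≡b%n c {a} {b} {m} eq = begin
  a % suc m                  ≡⟨ unshift a ⟨
  (c * m + (c + a)) % suc m  ≡⟨ [t+a]%n≡[t+b]%n (c * m) eq ⟩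
  (c * m + (c + b)) % suc m  ≡⟨ unshift b ⟩
  b % suc m                  ∎
  where
  open ≡-Reasoning
  -- c * m + c = c * suc m, so adding c * m undoes the shift by c.
  unshift : ∀ x → (c * m + (c + x)) % suc m ≡ x % suc m
  unshift x = trans (cong (_% suc m) (wrap c m x)) ([m+kn]%n≡m%n x c (suc m))
    where
    wrap : ∀ c m x → c * m + (c + x) ≡ x + c * suc m
    wrap = solve-∀

mod-≢-shift : ∀ {m} x d → suc d < suc m → x mod suc m ≢ (suc d + x) mod suc m
mod-≢-shift {m} x d d<n eq = <⇒≱ d<n (∣⇒≤ (m%n≡0⇒n∣m (suc d) (suc m) (sym 0≡d%n)))
  where
  open ≡-Reasoning
  0≡d%n : 0 ≡ suc d % suc m
  0≡d%n = [c+a]%n≡[c+b]%n⇒a%n≡b%n x (begin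
    (x + 0) % suc m              ≡⟨ cong (_% suc m) (+-identityʳ x) ⟩
    x % suc m                    ≡⟨ toℕ-mod x (suc m) ⟨
    toℕ (x mod suc m)            ≡⟨ cong toℕ eq ⟩
    toℕ ((suc d + x) mod suc m)  ≡⟨ toℕ-mod (suc d + x) (suc m) ⟩
    (suc d + x) % suc m          ≡⟨ cong (_% suc m) (+-comm (suc d) x) ⟩
    (x + suc d) % suc m          ∎)

[n+i]mod-n≡i : ∀ {m} (i : Fin (suc m)) → (suc m + toℕ i) mod suc m ≡ i
[n+i]mod-n≡i {m} i = toℕ-injective (begin
  toℕ ((suc m + toℕ i) mod suc m)  ≡⟨ toℕ-mod (suc m + toℕ i) (suc m) ⟩
  (suc m + toℕ i) % suc m          ≡⟨ %-remove-+ˡ (toℕ i) ∣-refl ⟩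
  toℕ i % suc m                    ≡⟨ m<n⇒m%n≡m (toℕ<n i) ⟩
  toℕ i                            ∎)
  where open ≡-Reasoning

cycle-neighbours : ∀ {m} x {y : Fin (suc m)} → CycAdj (suc m) y ((1 + x) mod suc m) →
                   y ≡ x mod suc m ⊎ y ≡ (2 + x) mod suc m
cycle-neighbours {m} x {y} (inj₁ eq) = inj₁ (toℕ-injective (begin
  toℕ y                ≡⟨ m<n⇒m%n≡m (toℕ<n y) ⟨
  toℕ y % suc m        ≡⟨ [c+a]%n≡[c+b]%n⇒a%n≡b%n 1 {m = m} y+1≡x+1 ⟩
  x % suc m            ≡⟨ toℕ-mod x (suc m) ⟨
  toℕ (x mod suc m)    ∎))
  where
  open ≡-Reasoning
  y+1≡x+1 : (1 + toℕ y) % suc m ≡ (1 + x) % suc m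
  y+1≡x+1 = begin
    (1 + toℕ y) % suc m          ≡⟨ cong (_% suc m) (+-comm 1 (toℕ y)) ⟩
    (toℕ y + 1) % suc m          ≡⟨ eq ⟨
    toℕ ((1 + x) mod suc m)      ≡⟨ toℕ-mod (1 + x) (suc m) ⟩
    (1 + x) % suc m              ∎
cycle-neighbours {m} x {y} (inj₂ eq) = inj₂ (toℕ-injective (begin
  toℕ y                               ≡⟨ eq ⟩
  (toℕ ((1 + x) mod suc m) + 1) % suc m  ≡⟨ cong (λ r → (r + 1) % suc m) (toℕ-mod (1 + x) (suc m)) ⟩
  ((1 + x) % suc m + 1) % suc m       ≡⟨ cong (_% suc m) (+-comm _ 1) ⟩
  (1 + (1 + x) % suc m) % suc m       ≡⟨ [t+a]%n≡[t+b]%n 1 {n = suc m} (m%n%n≡m%n (1 + x) (suc m)) ⟩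
  (2 + x) % suc m                     ≡⟨ toℕ-mod (2 + x) (suc m) ⟨
  toℕ ((2 + x) mod suc m)             ∎))
  where open ≡-Reasoning

module KₙCₙ (k : ℕ) where

  N : ℕ
  N = 5 + k

  G : Graph
  G = K N □ C N

  open DecMembership (≡-dec (_≟_ {N}) (_≟_ {N})) using (_∈?_)

  column : List (Fin N × Fin N)
  column = map (Fin.zero ,_) (allFin N)

  upper-bound : ∃ λ A → Unique A × Isolating G A × length A ≡ N
  upper-bound = column
              , map⁺ (cong proj₂) (allFin⁺ N)
              , dominating⇒isolating G column (column-dominates (C N) Fin.zero ∈-allFin)
              , trans (length-map _ (allFin N)) (length-tabulate id)

  module LowerBound (A : List (Fin N × Fin N)) (isolating : Isolating G A) where

    missed-layer-flanked : ∀ x → MissesLayer A ((1 + x) mod N) →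
                           ∃ λ e → ∀ i → i ≢ e → (i , x mod N) ∈ A ⊎ (i , (2 + x) mod N) ∈ A
    missed-layer-flanked x misses = all-but-one P? clash
      where
      P : Fin N → Set
      P i = (i , x mod N) ∈ A ⊎ (i , (2 + x) mod N) ∈ A

      P? : Decidable P
      P? i = ((i , x mod N) ∈? A) ⊎-dec ((i , (2 + x) mod N) ∈? A)

      flank : ∀ {i y} → CycAdj N y ((1 + x) mod N) → (i , y) ∈ A → P i
      flank adj y∈ with cycle-neighbours x adj
      ... | inj₁ refl = inj₁ y∈
      ... | inj₂ refl = inj₂ y∈

      undominated : ∀ {i} → ¬ P i → ¬ InClosedNbhd G A (i , (1 + x) mod N)
      undominated ¬Pi = ¬InClosedNbhd-□ (K N) (C N) misses (λ adj y∈ → ¬Pi (flank adj y∈))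

      clash : ∀ {i j} → i ≢ j → ¬ P i → ¬ P j → ⊥
      clash i≢j ¬Pi ¬Pj = isolating _ _ (undominated ¬Pi) (undominated ¬Pj) (inj₁ (i≢j , refl))

    module AroundMissedLayer (b : ℕ) (misses : MissesLayer A ((3 + b) mod N)) where

      -- ℓ 3 is the missed layer; counting from ℓ 0 keeps every layer index free of subtraction.
      ℓ : ℕ → Fin N
      ℓ c = (c + b) mod N

      ℓ-≢ : ∀ c (d : Fin 4) → ℓ c ≢ ℓ (suc (toℕ d) + c)
      ℓ-≢ c d eq = mod-≢-shift (c + b) (toℕ d) (≤-trans (s≤s (toℕ<n d)) (m≤m+n 5 k))
                     (trans eq (cong (_mod N) (+-assoc (suc (toℕ d)) c b)))

      p q : Fin N
      p = ℓ 2
      q = ℓ 4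

      OnFlank : Fin N × Fin N → Set
      OnFlank (_ , h) = h ≡ p ⊎ h ≡ q

      onFlank? : Decidable OnFlank
      onFlank? (_ , h) = (h ≟ p) ⊎-dec (h ≟ q)

      off-flank⇒≤length : (∃ λ v → v ∈ A × ¬ OnFlank v) → N ≤ length A
      off-flank⇒≤length off with missed-layer-flanked (2 + b) misses
      ... | e , covered = almost-onto⇒≤length onFlank? A proj₁ e off hit
        where
        hit : ∀ i → i ≢ e → ∃ λ v → v ∈ A × OnFlank v × proj₁ v ≡ i
        hit i i≢e with covered i i≢e
        ... | inj₁ ip∈ = (i , p) , ip∈ , inj₁ refl , refl
        ... | inj₂ iq∈ = (i , q) , iq∈ , inj₂ refl , refl

      module InsideFlanks (onFlank : ∀ {v} → v ∈ A → OnFlank v) where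

        missed : ∀ c → ℓ c ≢ p → ℓ c ≢ q → MissesLayer A (ℓ c)
        missed c ≢p ≢q v∈ h≡ℓc = [ ≢p ∘ trans (sym h≡ℓc) , ≢q ∘ trans (sym h≡ℓc) ]′ (onFlank v∈)

        missed₀ : MissesLayer A (ℓ 0)
        missed₀ = missed 0 (ℓ-≢ 0 (# 1)) (ℓ-≢ 0 (# 3))

        missed₁ : MissesLayer A (ℓ 1)
        missed₁ = missed 1 (ℓ-≢ 1 (# 0)) (ℓ-≢ 1 (# 2))

        missed₅ : MissesLayer A (ℓ 5)
        missed₅ = missed 5 (≢-sym (ℓ-≢ 2 (# 2))) (≢-sym (ℓ-≢ 4 (# 0)))

        missed₆ : MissesLayer A (ℓ 6)
        missed₆ = missed 6 (≢-sym (ℓ-≢ 2 (# 3))) (≢-sym (ℓ-≢ 4 (# 1)))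

        above : ∃ λ e → ∀ i → i ≢ e → (i , q) ∈ A ⊎ (i , ℓ 6) ∈ A
        above = missed-layer-flanked (4 + b) missed₅

        below : ∃ λ e → ∀ i → i ≢ e → (i , ℓ 0) ∈ A ⊎ (i , p) ∈ A
        below = missed-layer-flanked b missed₁

        in-q : ∀ i → i ≢ proj₁ above → (i , q) ∈ A
        in-q i i≢e = [ id , (λ i6∈ → ⊥-elim (missed₆ i6∈ refl)) ]′ (proj₂ above i i≢e)

        in-p : ∀ i → i ≢ proj₁ below → (i , p) ∈ A
        in-p i i≢e = [ (λ i0∈ → ⊥-elim (missed₀ i0∈ refl)) , id ]′ (proj₂ below i i≢e)

        -- Layer q hits every first coordinate except proj₁ above; a vertex of layer p stands in for it.
        lower-bound : N ≤ length A
        lower-bound = almost-onto⇒≤length (λ v → proj₂ v ≟ q) A proj₁ (proj₁ above)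
          ((i₋ , p) , in-p i₋ (punchInᵢ≢i (proj₁ below) Fin.zero) , ℓ-≢ 2 (# 1))
          (λ i i≢e → (i , q) , in-q i i≢e , refl , refl)
          where
          i₋ : Fin N
          i₋ = punchIn (proj₁ below) Fin.zero

      lower-bound : N ≤ length A
      lower-bound with any? (¬? ∘ onFlank?) A
      ... | yes off = off-flank⇒≤length (find off)
      ... | no ¬off = InsideFlanks.lower-bound
                        (λ {v} v∈ → decidable-stable (onFlank? v) (λ ¬on → ¬off (lose v∈ ¬on)))

    occupied? : Decidable (λ h → Any.Any (λ v → proj₂ v ≡ h) A)
    occupied? h = any? (λ v → proj₂ v ≟ h) A

    lower-bound : N ≤ length A
    lower-bound with all? occupied?
    ... | yes occupied = onto⇒≤length A proj₂ (λ h → find (occupied h))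
    ... | no ¬occupied with ¬∀⟶∃¬ N _ occupied? ¬occupied
    -- 3 + (2 + k + toℕ j) is N + toℕ j.
    ...   | j , unoccupied = AroundMissedLayer.lower-bound (2 + k + toℕ j)
                               (subst (MissesLayer A) (sym ([n+i]mod-n≡i j)) (λ v∈ h≡j → unoccupied (lose v∈ h≡j)))

  isolation-number : IsolationNumber G N
  isolation-number = upper-bound , LowerBound.lower-bound

proposition3p3 : (n : ℕ) → 5 ≤ n → IsolationNumber (K n □ C n) n
proposition3p3 n 5≤n with m≤n⇒∃[o]m+o≡n 5≤n
... | k , refl = KₙCₙ.isolation-number k
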